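{- Let $\mathfrak p_1,\mathfrak p_2\in L_{n,m}$ have height sequences $(h^{(1)}_1,\dots,h^{(1)}_n)$ and $(h^{(2)}_1,\dots,h^{(2)}_n)$. Then the relative pseudocomplement $\mathfrak p_1\to\mathfrak p_2$ in $\mathcal{L}_{n,m}$ is the path $\mathfrak p\in L_{n,m}$ with height sequence $(h_1,\dots,h_n)$ defined (recursively from the right) by $$h_i=\begin{cases} m,& i=n \text{ and } h^{(1)}_i\le h^{(2)}_i,\\ h_{i+1},& i<n \text{ and } h^{(1)}_i\le h^{(2)}_i,\\ h^{(2)}_i,& i\le n\text{ and } h^{(1)}_i>h^{(2)}_i.\end{cases}$$
   Context: $L_{n,m}$ is the set of lattice paths from $(0,0)$ to $(n,m)$ using up-steps $(0,1)$ and right-steps $(1,0)$. Such a path is uniquely determined by its height sequence $(h_1,\dots,h_n)$, where $h_i$ is the number of up-steps before the $i$-th right-step; these are exactly the integer sequences $0\le h_1\le h_2\le\dots\le h_n\le m$. $\mathcal{L}_{n,m}$ is $L_{n,m}$ with the dominance order: $\mathfrak p\le_D\mathfrak p'$ iff the height sequences satisfy $h_i\le h'_i$ for all $i$; it is a lattice with meet and join given by componentwise min and max. The relative pseudocomplement $x\to y$ is the greatest $z$ with $x\wedge z\le y$. -}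

module Defs where

open import Data.Nat using (ℕ; zero; suc; _≤_; _⊓_; _≤?_)
open import Data.Vec using (Vec; []; _∷_; zipWith; lookup)
open import Data.Fin using (Fin; suc; zero)
open import Data.Product using (_×_; Σ; _,_)
open import Relation.Nullary using (yes; no)
open import Relation.Binary.PropositionalEquality using (_≡_)
import Data.Nat.Properties
import Data.Vec.Properties

-- Height sequences (h₁,…,hₙ) as vectors; position i (0-based Fin n) holds h_{i+1}.
-- Weakly increasing and bounded by m.
data Increasing : {n : ℕ} → Vec ℕ n → Set where
  inc-[]  : Increasing []
  inc-[x] : ∀ {x} → Increasing (x ∷ [])
  inc-∷   : ∀ {n x y} {xs : Vec ℕ n} → x ≤ y → Increasing (y ∷ xs) → Increasing (x ∷ y ∷ xs)

Bounded : {n : ℕ} → ℕ → Vec ℕ n → Set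
Bounded {n} m h = (i : Fin n) → lookup h i ≤ m

record LPath (n m : ℕ) : Set where
  constructor mkPath
  field
    heights    : Vec ℕ n
    increasing : Increasing heights
    bounded    : Bounded m heights
open LPath public

_≤D_ : ∀ {n m} → LPath n m → LPath n m → Set
_≤D_ {n} p q = (i : Fin n) → lookup (heights p) i ≤ lookup (heights q) i

min-inc : ∀ {n} {a b : Vec ℕ n} → Increasing a → Increasing b → Increasing (zipWith _⊓_ a b)
min-inc inc-[] inc-[] = inc-[]
min-inc inc-[x] inc-[x] = inc-[x]
min-inc (inc-∷ p ps) (inc-∷ q qs) =
  inc-∷ (Data.Nat.Properties.⊓-mono-≤ p q) (min-inc ps qs)

min-bnd : ∀ {n m} {a b : Vec ℕ n} → Bounded m a → Bounded m b → Bounded m (zipWith _⊓_ a b)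
min-bnd {a = a} {b} ba bb i rewrite Data.Vec.Properties.lookup-zipWith _⊓_ i a b =
  Data.Nat.Properties.≤-trans (Data.Nat.Properties.m⊓n≤m _ _) (ba i)

_∧D_ : ∀ {n m} → LPath n m → LPath n m → LPath n m
p ∧D q = mkPath (zipWith _⊓_ (heights p) (heights q))
                (min-inc (increasing p) (increasing q))
                (min-bnd {a = heights p} {b = heights q} (bounded p) (bounded q))

IsRelPseudocomplement : ∀ {n m} → LPath n m → LPath n m → LPath n m → Set
IsRelPseudocomplement x y z =
  ((x ∧D z) ≤D y) × (∀ w → (x ∧D w) ≤D y → w ≤D z)

rpcHeights : ∀ {n} → ℕ → Vec ℕ n → Vec ℕ n → Vec ℕ n
rpcHeights m [] [] = []
rpcHeights m (a ∷ []) (b ∷ []) with a ≤? b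
... | yes _ = m ∷ []
... | no  _ = b ∷ []
rpcHeights m (a ∷ a' ∷ as) (b ∷ b' ∷ bs) with rpcHeights m (a' ∷ as) (b' ∷ bs)
... | t@(h' ∷ _) with a ≤? b
...   | yes _ = h' ∷ t
...   | no  _ = b ∷ t

module Submission where

-- Reading a height sequence together with the sentinel h₍ₙ₊₁₎ = m, a path is a chain
-- h₁ ≤ … ≤ hₙ ≤ m.  Componentwise, x ⊓ zᵢ ≤ yᵢ holds for every zᵢ when xᵢ ≤ yᵢ and
-- forces zᵢ ≤ yᵢ otherwise, so the largest admissible zᵢ is yᵢ in the second case
-- and, in the first, as large as the chain allows: the next entry zᵢ₊₁ (or m).
-- Taking exactly these values from the right gives a chain again, because the
-- value at a position is never below the corresponding entry of y.

open import Defs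
open import Data.Nat using (ℕ; _≤_; _⊓_; _≤?_)
open import Data.Nat.Properties
  using (≤-refl; ≤-trans; ≤-total; m⊓n≤m; m⊓n≤n; m≤n⇒m⊓n≡m; m≥n⇒m⊓n≡n)
open import Data.Vec using (Vec; []; _∷_; zipWith; lookup)
open import Data.Fin using (Fin; zero; suc)
open import Data.Product using (Σ; _×_; _,_)
open import Data.Sum using (inj₁; inj₂)
open import Relation.Nullary using (yes; no; ¬_; contradiction)
open import Relation.Binary.PropositionalEquality using (_≡_; refl; subst; sym)

_≤ᵛ_ : ∀ {n} → Vec ℕ n → Vec ℕ n → Set
_≤ᵛ_ {n} u v = (i : Fin n) → lookup u i ≤ lookup v i

headOr : ∀ {n} → ℕ → Vec ℕ n → ℕ
headOr m []      = m
headOr m (x ∷ _) = x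

data Chain (m : ℕ) : ∀ {n} → Vec ℕ n → Set where
  []  : Chain m []
  _∷_ : ∀ {n x} {xs : Vec ℕ n} → x ≤ headOr m xs → Chain m xs → Chain m (x ∷ xs)

path⇒chain : ∀ {n m} {v : Vec ℕ n} → Increasing v → Bounded m v → Chain m v
path⇒chain inc-[]       bnd = []
path⇒chain inc-[x]      bnd = bnd zero ∷ []
path⇒chain (inc-∷ p ps) bnd = p ∷ path⇒chain ps (λ i → bnd (suc i))

chain⇒increasing : ∀ {n m} {v : Vec ℕ n} → Chain m v → Increasing v
chain⇒increasing []              = inc-[]
chain⇒increasing (_ ∷ [])        = inc-[x]
chain⇒increasing (p ∷ c@(_ ∷ _)) = inc-∷ p (chain⇒increasing c)

headOr-chain-≤ : ∀ {n m} {v : Vec ℕ n} → Chain m v → headOr m v ≤ m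
headOr-chain-≤ []      = ≤-refl
headOr-chain-≤ (p ∷ c) = ≤-trans p (headOr-chain-≤ c)

chain⇒bounded : ∀ {n m} {v : Vec ℕ n} → Chain m v → Bounded m v
chain⇒bounded (p ∷ c) zero    = ≤-trans p (headOr-chain-≤ c)
chain⇒bounded (p ∷ c) (suc i) = chain⇒bounded c i

⊓-≤-cancelˡ : ∀ {a b} x → a ⊓ x ≤ b → ¬ a ≤ b → x ≤ b
⊓-≤-cancelˡ {a} {b} x a⊓x≤b a≰b with ≤-total a x
... | inj₁ a≤x = contradiction (subst (_≤ b) (m≤n⇒m⊓n≡m a≤x) a⊓x≤b) a≰b
... | inj₂ x≤a = subst (_≤ b) (m≥n⇒m⊓n≡n x≤a) a⊓x≤b

rpcEntry : (a b next : ℕ) → ℕ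
rpcEntry a b next with a ≤? b
... | yes _ = next
... | no  _ = b

-- rpcHeights with the case split moved into the head entry, so that
-- rpc m (a ∷ as) (b ∷ bs) reduces to a cons without deciding a ≤? b.
rpc : ∀ {n} → ℕ → Vec ℕ n → Vec ℕ n → Vec ℕ n
rpc m []       []       = []
rpc m (a ∷ as) (b ∷ bs) = rpcEntry a b (headOr m (rpc m as bs)) ∷ rpc m as bs

rpcHeights≡rpc : ∀ {n} m (as bs : Vec ℕ n) → rpcHeights m as bs ≡ rpc m as bs
rpcHeights≡rpc m []           []           = refl
rpcHeights≡rpc m (a ∷ [])     (b ∷ [])     with a ≤? b
... | yes _ = refl
... | no  _ = refl
rpcHeights≡rpc m (a ∷ a' ∷ as) (b ∷ b' ∷ bs)
  with rpcHeights m (a' ∷ as) (b' ∷ bs) | rpcHeights≡rpc m (a' ∷ as) (b' ∷ bs)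
... | _ | refl with a ≤? b
...   | yes _ = refl
...   | no  _ = refl

headOr-≤-rpc : ∀ {n m} (as : Vec ℕ n) {bs : Vec ℕ n} →
               Chain m bs → headOr m bs ≤ headOr m (rpc m as bs)
headOr-≤-rpc []       []      = ≤-refl
headOr-≤-rpc (a ∷ as) {b ∷ bs} (p ∷ c) with a ≤? b
... | yes _ = ≤-trans p (headOr-≤-rpc as c)
... | no  _ = ≤-refl

rpc-chain : ∀ {n m} (as : Vec ℕ n) {bs : Vec ℕ n} → Chain m bs → Chain m (rpc m as bs)
rpc-chain []       []      = []
rpc-chain (a ∷ as) {b ∷ bs} (p ∷ c) with a ≤? b
... | yes _ = ≤-refl ∷ rpc-chain as c
... | no  _ = ≤-trans p (headOr-≤-rpc as c) ∷ rpc-chain as c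

⊓-rpc-≤ : ∀ {n m} (as bs : Vec ℕ n) → zipWith _⊓_ as (rpc m as bs) ≤ᵛ bs
⊓-rpc-≤ (a ∷ as) (b ∷ bs) zero    with a ≤? b
... | yes a≤b = ≤-trans (m⊓n≤m a _) a≤b
... | no  _   = m⊓n≤n a b
⊓-rpc-≤ (a ∷ as) (b ∷ bs) (suc i) = ⊓-rpc-≤ as bs i

headOr-rpc-greatest : ∀ {n m} (as bs : Vec ℕ n) {ws : Vec ℕ n} → Chain m ws →
                      zipWith _⊓_ as ws ≤ᵛ bs → headOr m ws ≤ headOr m (rpc m as bs)
headOr-rpc-greatest []       []       []      _ = ≤-refl
headOr-rpc-greatest (a ∷ as) (b ∷ bs) {w ∷ ws} (p ∷ c) h with a ≤? b
... | yes _   = ≤-trans p (headOr-rpc-greatest as bs c (λ i → h (suc i)))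
... | no  a≰b = ⊓-≤-cancelˡ w (h zero) a≰b

rpc-greatest : ∀ {n m} (as bs : Vec ℕ n) {ws : Vec ℕ n} → Chain m ws →
               zipWith _⊓_ as ws ≤ᵛ bs → ws ≤ᵛ rpc m as bs
rpc-greatest (a ∷ as) (b ∷ bs) {_ ∷ _} c       h zero    = headOr-rpc-greatest (a ∷ as) (b ∷ bs) c h
rpc-greatest (a ∷ as) (b ∷ bs) {_ ∷ _} (_ ∷ c) h (suc i) = rpc-greatest as bs c (λ j → h (suc j)) i

theorem3p1 : (n m : ℕ) (p₁ p₂ : LPath n m) →
    Σ (LPath n m) λ p →
      (heights p ≡ rpcHeights m (heights p₁) (heights p₂))
      × IsRelPseudocomplement p₁ p₂ p
theorem3p1 n m p₁ p₂ =
  rpcPath , sym (rpcHeights≡rpc m a b) , ⊓-rpc-≤ a b , greatest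
  where
  a b : Vec ℕ n
  a = heights p₁
  b = heights p₂

  rpcChain : Chain m (rpc m a b)
  rpcChain = rpc-chain a (path⇒chain (increasing p₂) (bounded p₂))

  rpcPath : LPath n m
  rpcPath = mkPath (rpc m a b) (chain⇒increasing rpcChain) (chain⇒bounded rpcChain)

  greatest : ∀ w → (p₁ ∧D w) ≤D p₂ → w ≤D rpcPath
  greatest w = rpc-greatest a b (path⇒chain (increasing w) (bounded w))
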